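{- Consider three agents $a,b,c$, each starting with a private binary input value in $\{0,1\}$ (all $8$ input assignments are possible), communicating in the full-information immediate snapshot model for $R$ rounds, where $R$ is any finite number of rounds. Then the $0$-majority consensus task is not solvable: there is no assignment of a decision value in $\{0,1\}$ to each possible final local state of each agent such that, for every input assignment and every sequence of $R$ communication graphs from the immediate snapshot model, the resulting triple of outputs satisfies majority agreement and validity.
   Context: Agents are $\mathrm{Ag}=\{a,b,c\}$. A communication graph is a reflexive binary relation $G\subseteq \mathrm{Ag}\times\mathrm{Ag}$; $x\to y$ means the message of $x$ is delivered to $y$. Full-information protocol: initially each agent's local state is its input value. In each round a communication graph $G$ is chosen arbitrarily (independently each round) from a fixed set $M$ of graphs; every agent sends its entire current local state, and the new local state of agent $y$ is the tuple $[\ell_a,\ell_b,\ell_c]$ where entry $x$ is the previous local state $\ell_x$ of $x$ if $x\to y$ in $G$ and a symbol $\bot$ otherwise (agents always receive their own state, so nothing is forgotten). After $R$ rounds each agent must choose an output in $\{0,1\}$ as a function of its final local state only. The immediate snapshot model is the set $M_{IS}$ of the $13$ graphs obtained as follows: choose an ordered partition of $\mathrm{Ag}$ into nonempty blocks $B_1,\dots,B_k$; agent $y\in B_j$ receives messages exactly from the agents in $B_1\cup\dots\cup B_j$. The $0$-majority consensus task: with inputs $(x_a,x_b,x_c)\in\{0,1\}^3$ and outputs $(y_a,y_b,y_c)\in\{0,1\}^3$, (majority agreement) either $y_a=y_b=y_c$ or at least two of the outputs equal $0$; (validity) every output value is among the input values (in particular, if all inputs are equal to $v$, all outputs equal $v$).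 The task is solvable if decision functions exist making every execution satisfy both conditions. -}

module Defs where

open import Data.Bool using (Bool; true; false; T; _∧_; _∨_)
open import Data.Maybe using (Maybe; just; nothing)
open import Data.Nat using (ℕ; zero; suc; _≤_; _<_)
open import Data.Fin using (Fin; toℕ)
open import Data.Vec using (Vec; []; _∷_; foldl)
open import Data.Product using (Σ; _×_; _,_; ∃)
open import Data.Sum using (_⊎_)
open import Relation.Binary.PropositionalEquality using (_≡_)

data Agent : Set where
  a b c : Agent

-- Communication graphs: G x y holds (true) iff x → y, i.e. the message of x is delivered to y.
Graph : Set
Graph = Agent → Agent → Bool

Reflexive : Graph → Set
Reflexive G = ∀ x → G x x ≡ true

-- Ordered partition of Ag into nonempty blocks B_1,…,B_k, encoded by the block
-- index (0-based) of each agent; the blocks are nonempty iff every index below k is used.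
record OrderedPartition : Set where
  field
    k        : ℕ
    block    : Agent → Fin k
    nonempty : (i : Fin k) → ∃ λ x → block x ≡ i

isGraph : OrderedPartition → Graph
isGraph P x y = toℕ (block x) Data.Nat.≤ᵇ toℕ (block y)
  where open OrderedPartition P

InIS : Graph → Set
InIS G = Σ OrderedPartition λ P → ∀ x y → G x y ≡ isGraph P x y

data LocalState : Set where
  input : Bool → LocalState
  tuple : Maybe LocalState → Maybe LocalState → Maybe LocalState → LocalState

Config : Set
Config = Agent → LocalState

deliver : Graph → Config → Agent → Agent → Maybe LocalState
deliver G ℓ x y with G x y
... | true  = just (ℓ x)
... | false = nothing

step : Config → Graph → Config
step ℓ G y = tuple (deliver G ℓ a y) (deliver G ℓ b y) (deliver G ℓ c y)

run : ∀ {R} → (Agent → Bool) → Vec Graph R → Config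
run inp gs = foldl (λ _ → Config) step (λ x → input (inp x)) gs

AllIS : ∀ {R} → Vec Graph R → Set
AllIS []       = Data.Unit.⊤
  where import Data.Unit
AllIS (G ∷ gs) = InIS G × AllIS gs

Decision : Set
Decision = Agent → LocalState → Bool

MajorityAgreement : (Agent → Bool) → Set
MajorityAgreement y =
  ((y a ≡ y b) × (y b ≡ y c))
  ⊎ ((y a ≡ false × y b ≡ false) ⊎ ((y a ≡ false × y c ≡ false) ⊎ (y b ≡ false × y c ≡ false)))

Validity : (Agent → Bool) → (Agent → Bool) → Set
Validity x y = ∀ (p : Agent) → ∃ λ q → y p ≡ x q

Solvable : ℕ → Set
Solvable R = Σ Decision λ δ →
  ∀ (inp : Agent → Bool) (gs : Vec Graph R) → AllIS gs →
    let out = λ p → δ p (run inp gs p)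
    in MajorityAgreement out × Validity inp out

-- If two configurations differ only in the state of agent z, every IS execution from the first
-- ends with all decisions 1, and every execution from the second satisfies 0-majority agreement,
-- then every execution from the second also ends with all decisions 1. With no rounds left, the
-- two other agents decide 1 and 0-majority agreement forces z to decide 1 too. Otherwise let z
-- run alone after the others in the first round: they do not hear from z, so the two successor
-- configurations still differ only at z, and induction applies. The 13 IS graphs are connected
-- through graphs giving all but one agent the same view, so induction spreads the conclusion to
-- every first round. Starting from inputs 111, where validity forces decision 1, and flipping
-- inputs one agent at a time reaches 000, where validity forbids it.

module Submission where

open import Defs
open import Data.Nat using (ℕ; zero; suc; _<_; _≤ᵇ_; _≤?_)
open import Data.Nat.Properties using (≤-refl; <⇒≤; <⇒≱; <-trans; <-cmp; <-≤-trans; ≤-<-trans; ≤-reflexive)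
open import Data.Fin using (toℕ)
open import Data.Fin.Patterns using (0F; 1F; 2F)
open import Data.Bool using (Bool; true; false)
open import Data.Bool.Properties using (not-¬)
open import Data.Maybe using (just; nothing)
open import Data.Unit using (tt)
open import Data.Vec using (Vec; []; _∷_; foldl)
open import Data.Product using (Σ; _×_; _,_; proj₁; proj₂; swap)
open import Data.Sum using (inj₁; inj₂)
open import Data.Empty using (⊥-elim)
open import Function using (_∘_; id)
open import Relation.Nullary using (¬_)
open import Relation.Nullary.Decidable using (dec-true; dec-false)
open import Relation.Binary using (tri<; tri≈; tri>)
open import Relation.Binary.PropositionalEquality using (_≡_; refl; sym; trans; cong; cong₂; subst)
open import Relation.Binary.Construct.Closure.ReflexiveTransitive using (Star; ε; _◅_; _◅◅_; reverse; fold)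

-- The 13 ordered partitions of {a, b, c}, named by listing their blocks in order.

data Shape : Set where
  abc a∣bc b∣ac c∣ab bc∣a ac∣b ab∣c a∣b∣c a∣c∣b b∣a∣c b∣c∣a c∣a∣b c∣b∣a : Shape

partition : Shape → OrderedPartition
partition abc   = record { k = 1 ; block = λ _ → 0F
                         ; nonempty = λ { 0F → a , refl } }
partition a∣bc  = record { k = 2 ; block = λ { a → 0F ; _ → 1F }
                         ; nonempty = λ { 0F → a , refl ; 1F → b , refl } }
partition b∣ac  = record { k = 2 ; block = λ { b → 0F ; _ → 1F }
                         ; nonempty = λ { 0F → b , refl ; 1F → a , refl } }
partition c∣ab  = record { k = 2 ; block = λ { c → 0F ; _ → 1F }
                         ; nonempty = λ { 0F → c , refl ; 1F → a , refl } }
partition bc∣a  = record { k = 2 ; block = λ { a → 1F ; _ → 0F }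
                         ; nonempty = λ { 0F → b , refl ; 1F → a , refl } }
partition ac∣b  = record { k = 2 ; block = λ { b → 1F ; _ → 0F }
                         ; nonempty = λ { 0F → a , refl ; 1F → b , refl } }
partition ab∣c  = record { k = 2 ; block = λ { c → 1F ; _ → 0F }
                         ; nonempty = λ { 0F → a , refl ; 1F → c , refl } }
partition a∣b∣c = record { k = 3 ; block = λ { a → 0F ; b → 1F ; c → 2F }
                         ; nonempty = λ { 0F → a , refl ; 1F → b , refl ; 2F → c , refl } }
partition a∣c∣b = record { k = 3 ; block = λ { a → 0F ; c → 1F ; b → 2F }
                         ; nonempty = λ { 0F → a , refl ; 1F → c , refl ; 2F → b , refl } }
partition b∣a∣c = record { k = 3 ; block = λ { b → 0F ; a → 1F ; c → 2F }
                         ; nonempty = λ { 0F → b , refl ; 1F → a , refl ; 2F → c , refl } }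
partition b∣c∣a = record { k = 3 ; block = λ { b → 0F ; c → 1F ; a → 2F }
                         ; nonempty = λ { 0F → b , refl ; 1F → c , refl ; 2F → a , refl } }
partition c∣a∣b = record { k = 3 ; block = λ { c → 0F ; a → 1F ; b → 2F }
                         ; nonempty = λ { 0F → c , refl ; 1F → a , refl ; 2F → b , refl } }
partition c∣b∣a = record { k = 3 ; block = λ { c → 0F ; b → 1F ; a → 2F }
                         ; nonempty = λ { 0F → c , refl ; 1F → b , refl ; 2F → a , refl } }

shapeGraph : Shape → Graph
shapeGraph w = isGraph (partition w)

shapeGraph-IS : ∀ w → InIS (shapeGraph w)
shapeGraph-IS w = partition w , λ _ _ → refl

rankGraph : (Agent → ℕ) → Graph
rankGraph N x y = N x ≤ᵇ N y

PairAgree : (Agent → ℕ) → (Agent → ℕ) → Agent → Agent → Set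
PairAgree N M x y = rankGraph N x y ≡ rankGraph M x y × rankGraph N y x ≡ rankGraph M y x

≤ᵇ-refl : ∀ n → (n ≤ᵇ n) ≡ true
≤ᵇ-refl n = dec-true (n ≤? n) ≤-refl

<-pair : ∀ {m n} → m < n → (m ≤ᵇ n) ≡ true × (n ≤ᵇ m) ≡ false
<-pair {m} {n} m<n = dec-true (m ≤? n) (<⇒≤ m<n) , dec-false (n ≤? m) (<⇒≱ m<n)

>-pair : ∀ {m n} → n < m → (m ≤ᵇ n) ≡ false × (n ≤ᵇ m) ≡ true
>-pair = swap ∘ <-pair

≡-pair : ∀ {m n} → m ≡ n → (m ≤ᵇ n) ≡ true × (n ≤ᵇ m) ≡ true
≡-pair {m} refl = ≤ᵇ-refl m , ≤ᵇ-refl m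

rank : Shape → Agent → ℕ
rank w x = toℕ (OrderedPartition.block (partition w) x)

ordered-as : ∀ N w → PairAgree N (rank w) a b → PairAgree N (rank w) b c → PairAgree N (rank w) a c
           → Σ Shape λ w → ∀ x y → rankGraph N x y ≡ shapeGraph w x y
ordered-as N w ab bc ac = w , agree
  where
  agree : ∀ x y → rankGraph N x y ≡ rankGraph (rank w) x y
  agree a a = trans (≤ᵇ-refl (N a)) (sym (≤ᵇ-refl (rank w a)))
  agree b b = trans (≤ᵇ-refl (N b)) (sym (≤ᵇ-refl (rank w b)))
  agree c c = trans (≤ᵇ-refl (N c)) (sym (≤ᵇ-refl (rank w c)))
  agree a b = proj₁ ab
  agree b a = proj₂ ab
  agree b c = proj₁ bc
  agree c b = proj₂ bc
  agree a c = proj₁ ac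
  agree c a = proj₂ ac

orderType : (N : Agent → ℕ) → Σ Shape λ w → ∀ x y → rankGraph N x y ≡ shapeGraph w x y
orderType N with <-cmp (N a) (N b) | <-cmp (N b) (N c) | <-cmp (N a) (N c)
... | tri< a<b _ _ | tri< b<c _ _ | _ =
  ordered-as N a∣b∣c (<-pair a<b) (<-pair b<c) (<-pair (<-trans a<b b<c))
... | tri< a<b _ _ | tri≈ _ b=c _ | _ =
  ordered-as N a∣bc (<-pair a<b) (≡-pair b=c) (<-pair (<-≤-trans a<b (≤-reflexive b=c)))
... | tri< a<b _ _ | tri> _ _ c<b | tri< a<c _ _ =
  ordered-as N a∣c∣b (<-pair a<b) (>-pair c<b) (<-pair a<c)
... | tri< a<b _ _ | tri> _ _ c<b | tri≈ _ a=c _ =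
  ordered-as N ac∣b (<-pair a<b) (>-pair c<b) (≡-pair a=c)
... | tri< a<b _ _ | tri> _ _ c<b | tri> _ _ c<a =
  ordered-as N c∣a∣b (<-pair a<b) (>-pair c<b) (>-pair c<a)
... | tri≈ _ a=b _ | tri< b<c _ _ | _ =
  ordered-as N ab∣c (≡-pair a=b) (<-pair b<c) (<-pair (≤-<-trans (≤-reflexive a=b) b<c))
... | tri≈ _ a=b _ | tri≈ _ b=c _ | _ =
  ordered-as N abc (≡-pair a=b) (≡-pair b=c) (≡-pair (trans a=b b=c))
... | tri≈ _ a=b _ | tri> _ _ c<b | _ =
  ordered-as N c∣ab (≡-pair a=b) (>-pair c<b) (>-pair (<-≤-trans c<b (≤-reflexive (sym a=b))))
... | tri> _ _ b<a | tri< b<c _ _ | tri< a<c _ _ =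
  ordered-as N b∣a∣c (>-pair b<a) (<-pair b<c) (<-pair a<c)
... | tri> _ _ b<a | tri< b<c _ _ | tri≈ _ a=c _ =
  ordered-as N b∣ac (>-pair b<a) (<-pair b<c) (≡-pair a=c)
... | tri> _ _ b<a | tri< b<c _ _ | tri> _ _ c<a =
  ordered-as N b∣c∣a (>-pair b<a) (<-pair b<c) (>-pair c<a)
... | tri> _ _ b<a | tri≈ _ b=c _ | _ =
  ordered-as N bc∣a (>-pair b<a) (≡-pair b=c) (>-pair (≤-<-trans (≤-reflexive (sym b=c)) b<a))
... | tri> _ _ b<a | tri> _ _ c<b | _ =
  ordered-as N c∣b∣a (>-pair b<a) (>-pair c<b) (>-pair (<-trans c<b b<a))

classify : ∀ {G} → InIS G → Σ Shape λ w → ∀ x y → G x y ≡ shapeGraph w x y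
classify (P , G≡P) with orderType (toℕ ∘ OrderedPartition.block P)
... | w , P≡w = w , λ x y → trans (G≡P x y) (P≡w x y)

others : Agent → Agent × Agent
others a = b , c
others b = a , c
others c = a , b

record AgreeExcept {A : Set} (z : Agent) (f g : Agent → A) : Set where
  constructor _,_
  field
    at-first  : f (proj₁ (others z)) ≡ g (proj₁ (others z))
    at-second : f (proj₂ (others z)) ≡ g (proj₂ (others z))

module _ {A : Set} where

  pointwise⇒AgreeExcept : ∀ z {f g : Agent → A} → (∀ x → f x ≡ g x) → AgreeExcept z f g
  pointwise⇒AgreeExcept z f≡g = f≡g _ , f≡g _

  AgreeExcept-sym : ∀ {z} {f g : Agent → A} → AgreeExcept z f g → AgreeExcept z g f
  AgreeExcept-sym (e₁ , e₂) = sym e₁ , sym e₂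

  AgreeExcept-trans : ∀ {z} {f g h : Agent → A} → AgreeExcept z f g → AgreeExcept z g h → AgreeExcept z f h
  AgreeExcept-trans (e₁ , e₂) (e₁′ , e₂′) = trans e₁ e₁′ , trans e₂ e₂′

  AgreeExcept-map : ∀ {z} {B : Set} (φ : Agent → A → B) {f g : Agent → A}
                  → AgreeExcept z f g → AgreeExcept z (λ x → φ x (f x)) (λ x → φ x (g x))
  AgreeExcept-map φ (e₁ , e₂) = cong (φ _) e₁ , cong (φ _) e₂

  AgreeExcept-complete : ∀ z {f : Agent → A} {v} → AgreeExcept z f (λ _ → v) → f z ≡ v → ∀ x → f x ≡ v
  AgreeExcept-complete a (_  , _ ) fz a = fz
  AgreeExcept-complete a (fb , _ ) _  b = fb
  AgreeExcept-complete a (_  , fc) _  c = fc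
  AgreeExcept-complete b (fa , _ ) _  a = fa
  AgreeExcept-complete b (_  , _ ) fz b = fz
  AgreeExcept-complete b (_  , fc) _  c = fc
  AgreeExcept-complete c (fa , _ ) _  a = fa
  AgreeExcept-complete c (_  , fb) _  b = fb
  AgreeExcept-complete c (_  , _ ) fz c = fz

deliver-cong : ∀ {G H} ℓ x y → G x y ≡ H x y → deliver G ℓ x y ≡ deliver H ℓ x y
deliver-cong {G} {H} ℓ x y G≡H rewrite G≡H = refl

step-cong : ∀ {G H} → (∀ x y → G x y ≡ H x y) → ∀ ℓ y → step ℓ G y ≡ step ℓ H y
step-cong {G} {H} G≡H ℓ y
  rewrite deliver-cong {G} {H} ℓ a y (G≡H a y)
        | deliver-cong {G} {H} ℓ b y (G≡H b y)
        | deliver-cong {G} {H} ℓ c y (G≡H c y) = refl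

lastAlone : Agent → Shape
lastAlone a = bc∣a
lastAlone b = ac∣b
lastAlone c = ab∣c

step-lastAlone : ∀ z {ℓ ℓ′} → AgreeExcept z ℓ ℓ′
               → AgreeExcept z (step ℓ (shapeGraph (lastAlone z))) (step ℓ′ (shapeGraph (lastAlone z)))
step-lastAlone a (eb , ec) = let e = cong₂ (λ u v → tuple nothing (just u) (just v)) eb ec in e , e
step-lastAlone b (ea , ec) = let e = cong₂ (λ u v → tuple (just u) nothing (just v)) ea ec in e , e
step-lastAlone c (ea , eb) = let e = cong₂ (λ u v → tuple (just u) (just v) nothing) ea eb in e , e

ISGraph : Set
ISGraph = Σ Graph InIS

shapeIS : Shape → ISGraph
shapeIS w = shapeGraph w , shapeGraph-IS w

record Neighbours (G H : ISGraph) : Set where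
  constructor differ-at
  field
    agent : Agent
    views : ∀ ℓ → AgreeExcept agent (step ℓ (proj₁ G)) (step ℓ (proj₁ H))

Neighbours-sym : ∀ {G H} → Neighbours G H → Neighbours H G
Neighbours-sym (differ-at z G~H) = differ-at z λ ℓ → AgreeExcept-sym (G~H ℓ)

-- A spanning tree of depth 3 rooted at abc, which is taken to be its own parent.
parent : Shape → Shape
parent abc   = abc
parent a∣bc  = abc
parent b∣ac  = abc
parent c∣ab  = abc
parent a∣b∣c = a∣bc
parent a∣c∣b = a∣bc
parent b∣a∣c = b∣ac
parent b∣c∣a = b∣ac
parent c∣a∣b = c∣ab
parent c∣b∣a = c∣ab
parent ab∣c  = a∣b∣c
parent ac∣b  = a∣c∣b
parent bc∣a  = b∣c∣a

to-parent : ∀ w → Neighbours (shapeIS w) (shapeIS (parent w))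
to-parent abc   = differ-at a λ _ → refl , refl
to-parent a∣bc  = differ-at a λ _ → refl , refl
to-parent b∣ac  = differ-at b λ _ → refl , refl
to-parent c∣ab  = differ-at c λ _ → refl , refl
to-parent a∣b∣c = differ-at b λ _ → refl , refl
to-parent a∣c∣b = differ-at c λ _ → refl , refl
to-parent b∣a∣c = differ-at a λ _ → refl , refl
to-parent b∣c∣a = differ-at c λ _ → refl , refl
to-parent c∣a∣b = differ-at a λ _ → refl , refl
to-parent c∣b∣a = differ-at b λ _ → refl , refl
to-parent ab∣c  = differ-at a λ _ → refl , refl
to-parent ac∣b  = differ-at a λ _ → refl , refl
to-parent bc∣a  = differ-at b λ _ → refl , refl

parent³≡abc : ∀ w → parent (parent (parent w)) ≡ abc
parent³≡abc = λ { abc → refl ; a∣bc → refl ; b∣ac → refl ; c∣ab → refl ; bc∣a → refl ; ac∣b → refl ; ab∣c → refl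
                ; a∣b∣c → refl ; a∣c∣b → refl ; b∣a∣c → refl ; b∣c∣a → refl ; c∣a∣b → refl ; c∣b∣a → refl }

shape-path-to-abc : ∀ w → Star Neighbours (shapeIS w) (shapeIS abc)
shape-path-to-abc w = subst (Star Neighbours (shapeIS w) ∘ shapeIS) (parent³≡abc w)
                            (to-parent w ◅ to-parent (parent w) ◅ to-parent (parent (parent w)) ◅ ε)

path-to-abc : ∀ G → Star Neighbours G (shapeIS abc)
path-to-abc (G , G-IS) with classify G-IS
... | w , G≡w = differ-at a (λ ℓ → pointwise⇒AgreeExcept a (step-cong G≡w ℓ)) ◅ shape-path-to-abc w

IS-connected : ∀ G H → Star Neighbours G H
IS-connected G H = path-to-abc G ◅◅ reverse Neighbours-sym (path-to-abc H)

majority-forces-true : ∀ z (o : Agent → Bool) → MajorityAgreement o → AgreeExcept z o (λ _ → true) → o z ≡ true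
majority-forces-true a o (inj₁ (ab , _))  (ob , _)  = trans ab ob
majority-forces-true b o (inj₁ (_ , bc))  (_  , oc) = trans bc oc
majority-forces-true c o (inj₁ (_ , bc))  (_  , ob) = trans (sym bc) ob
majority-forces-true a o (inj₂ (inj₁ (_ , fb)))          (ob , _)  = ⊥-elim (not-¬ ob fb)
majority-forces-true a o (inj₂ (inj₂ (inj₁ (_ , fc))))   (_  , oc) = ⊥-elim (not-¬ oc fc)
majority-forces-true a o (inj₂ (inj₂ (inj₂ (fb , _))))   (ob , _)  = ⊥-elim (not-¬ ob fb)
majority-forces-true b o (inj₂ (inj₁ (fa , _)))          (oa , _)  = ⊥-elim (not-¬ oa fa)
majority-forces-true b o (inj₂ (inj₂ (inj₁ (fa , _))))   (oa , _)  = ⊥-elim (not-¬ oa fa)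
majority-forces-true b o (inj₂ (inj₂ (inj₂ (_ , fc))))   (_  , oc) = ⊥-elim (not-¬ oc fc)
majority-forces-true c o (inj₂ (inj₁ (fa , _)))          (oa , _)  = ⊥-elim (not-¬ oa fa)
majority-forces-true c o (inj₂ (inj₂ (inj₁ (fa , _))))   (oa , _)  = ⊥-elim (not-¬ oa fa)
majority-forces-true c o (inj₂ (inj₂ (inj₂ (fb , _))))   (_  , ob) = ⊥-elim (not-¬ ob fb)

runFrom : ∀ {k} → Config → Vec Graph k → Config
runFrom ℓ gs = foldl (λ _ → Config) step ℓ gs

module _ (δ : Decision) where

  output : ∀ {k} → Config → Vec Graph k → Agent → Bool
  output ℓ gs p = δ p (runFrom ℓ gs p)

  AlwaysAgrees : ℕ → Config → Set
  AlwaysAgrees k ℓ = ∀ (gs : Vec Graph k) → AllIS gs → MajorityAgreement (output ℓ gs)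

  AlwaysTrue : ℕ → Config → Set
  AlwaysTrue k ℓ = ∀ (gs : Vec Graph k) → AllIS gs → ∀ p → output ℓ gs p ≡ true

  AlwaysAgrees-step : ∀ {k ℓ G} → AlwaysAgrees (suc k) ℓ → InIS G → AlwaysAgrees k (step ℓ G)
  AlwaysAgrees-step agrees G-IS gs gs-IS = agrees (_ ∷ gs) (G-IS , gs-IS)

  AlwaysTrue-step : ∀ {k ℓ G} → AlwaysTrue (suc k) ℓ → InIS G → AlwaysTrue k (step ℓ G)
  AlwaysTrue-step all-true G-IS gs gs-IS = all-true (_ ∷ gs) (G-IS , gs-IS)

  propagate-true : ∀ k z {ℓ ℓ′} → AgreeExcept z ℓ ℓ′ → AlwaysTrue k ℓ → AlwaysAgrees k ℓ′ → AlwaysTrue k ℓ′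
  propagate-true zero z {ℓ′ = ℓ′} ℓ~ℓ′ all-true agrees [] _ =
    AgreeExcept-complete z off-z (majority-forces-true z (output ℓ′ []) (agrees [] tt) off-z)
    where
    off-z : AgreeExcept z (output ℓ′ []) (λ _ → true)
    off-z = AgreeExcept-trans (AgreeExcept-sym (AgreeExcept-map δ ℓ~ℓ′))
                              (pointwise⇒AgreeExcept z (all-true [] tt))
  propagate-true (suc k) z {ℓ′ = ℓ′} ℓ~ℓ′ all-true agrees (G ∷ gs) (G-IS , gs-IS) =
    fold (λ H H′ → Q H → Q H′) (λ n f → f ∘ hop n) id (IS-connected (shapeIS (lastAlone z)) (G , G-IS))
      true-after-lastAlone gs gs-IS
    where
    Q : ISGraph → Set
    Q H = AlwaysTrue k (step ℓ′ (proj₁ H))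

    hop : ∀ {H H′} → Neighbours H H′ → Q H → Q H′
    hop {H′ = _ , H′-IS} (differ-at y views) q =
      propagate-true k y (views ℓ′) q (AlwaysAgrees-step agrees H′-IS)

    true-after-lastAlone : Q (shapeIS (lastAlone z))
    true-after-lastAlone = propagate-true k z (step-lastAlone z ℓ~ℓ′)
      (AlwaysTrue-step all-true (shapeGraph-IS (lastAlone z)))
      (AlwaysAgrees-step agrees (shapeGraph-IS (lastAlone z)))

initial : (Agent → Bool) → Config
initial inp x = input (inp x)

IS-schedule : ∀ k → Σ (Vec Graph k) AllIS
IS-schedule zero    = [] , tt
IS-schedule (suc k) = let gs , gs-IS = IS-schedule k in shapeGraph abc ∷ gs , shapeGraph-IS abc , gs-IS

mainTheorem1 : (R : ℕ) → ¬ Solvable R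
mainTheorem1 R (δ , solves) =
  let gs , gs-IS = IS-schedule R in
  not-¬ (true-on-000 gs gs-IS a) (proj₂ (proj₂ (solves _ gs gs-IS) a))
  where
  agrees : ∀ inp → AlwaysAgrees δ R (initial inp)
  agrees inp gs gs-IS = proj₁ (solves inp gs gs-IS)

  true-on-111 : AlwaysTrue δ R (initial λ _ → true)
  true-on-111 gs gs-IS p = proj₂ (proj₂ (solves _ gs gs-IS) p)

  true-on-000 : AlwaysTrue δ R (initial λ _ → false)
  true-on-000 =
    propagate-true δ R a (refl , refl) (
    propagate-true δ R b (refl , refl) (
    propagate-true δ R c (refl , refl) true-on-111
      (agrees λ { c → false ; _ → true }))
      (agrees λ { a → true ; _ → false }))
      (agrees λ _ → false)
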